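{- If $\Gamma_1\longrightarrow\Delta_1$ and $\Gamma_2\longrightarrow\Delta_2$ are two sequents appearing along a common path in a C-proof (respectively, an I-proof), with the first appearing before the second (i.e., the second lies on the path from the first down to the end-sequent), then $\Gamma_1\succeq\Gamma_2$.
   Context: Formulas are first-order with logical symbols $\top,\bot,\land,\lor,\supset,\exists,\forall$. A sequent $\Gamma\longrightarrow\Delta$ is a pair of finite multisets of formulas. A C-proof is a derivation tree (root = end-sequent) in the classical multiple-succedent sequent calculus whose axioms are sequents with $\top\in\Delta$ or with some $A$ ($\bot$ or atomic) in both $\Gamma$ and $\Delta$, and whose rules are: contr-L ($B,B,\Gamma\longrightarrow\Delta\Rightarrow B,\Gamma\longrightarrow\Delta$), contr-R ($\Gamma\longrightarrow\Delta,B,B\Rightarrow\Gamma\longrightarrow\Delta,B$), $\bot$-R ($\Gamma\longrightarrow\Delta,\bot\Rightarrow\Gamma\longrightarrow\Delta,D$), $\land$-L ($B,D,B\land D,\Gamma\longrightarrow\Delta\Rightarrow B\land D,\Gamma\longrightarrow\Delta$), $\land$-R ($\Gamma\longrightarrow\Delta,B$ and $\Gamma\longrightarrow\Delta,D\Rightarrow\Gamma\longrightarrow\Delta,B\land D$), $\lor$-L ($B,\Gamma\longrightarrow\Delta$ and $D,\Gamma\longrightarrow\Delta\Rightarrow B\lor D,\Gamma\longrightarrow\Delta$), $\lor$-R ($\Gamma\longrightarrow\Delta,B$ or $\Gamma\longrightarrow\Delta,D\Rightarrow\Gamma\longrightarrow\Delta,B\lor D$), $\supset$-L ($B\supset D,\Gamma\longrightarrow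 B,\Delta$ and $D,\Gamma\longrightarrow\Theta\Rightarrow B\supset D,\Gamma\longrightarrow\Delta,\Theta$), $\supset$-R ($B,\Gamma\longrightarrow\Delta,D\Rightarrow\Gamma\longrightarrow\Delta,B\supset D$), $\forall$-L ($[t/x]B,\forall xB,\Gamma\longrightarrow\Delta\Rightarrow\forall xB,\Gamma\longrightarrow\Delta$), $\exists$-R ($\Gamma\longrightarrow\Delta,[t/x]B\Rightarrow\Gamma\longrightarrow\Delta,\exists xB$), $\exists$-L ($[c/x]B,\Gamma\longrightarrow\Delta\Rightarrow\exists xB,\Gamma\longrightarrow\Delta$), $\forall$-R ($\Gamma\longrightarrow\Delta,[c/x]B\Rightarrow\Gamma\longrightarrow\Delta,\forall xB$), $c$ a constant not in the lower sequent. An I-proof is a C-proof in which every sequent has exactly one succedent formula. The relation $\succeq$ on formulas: $F_1\succeq F_2$ iff $F_1=F_2$, or $F_2$ is $A\supset B$ and $F_1\succeq B$, or $F_2$ is $A\lor B$ and ($F_1\succeq A$ or $F_1\succeq B$), or $F_2$ is $\exists x P$ and $F_1\succeq[c/x]P$ for some constant $c$. For multisets, $\Gamma_1\succeq\Gamma_2$ iff there is a one-to-one map $\kappa:\Gamma_2\to\Gamma_1$ with $\kappa(F)\succeq F$ for all $F$. -}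

module Defs where

open import Data.Nat using (ℕ; zero; suc; _≡ᵇ_; _<ᵇ_)
open import Data.Bool using (Bool; true; false; _∨_; if_then_else_)
open import Data.List using (List; []; _∷_; _++_; length; lookup)
open import Data.List.Membership.Propositional using (_∈_)
open import Data.List.Relation.Binary.Permutation.Propositional using (_↭_)
open import Data.Fin using (Fin)
open import Data.Product using (Σ; _×_; _,_; proj₁; proj₂)
open import Data.Empty using (⊥)
open import Data.Unit using (⊤)
open import Relation.Binary.PropositionalEquality using (_≡_)
open import Function.Definitions using (Injective)

-- First-order terms and formulas (de Bruijn indices for bound
-- variables; constants (eigenvariables) and function/predicate symbols
-- named by natural numbers).

data Term : Set where
  var : ℕ → Term
  con : ℕ → Term
  fun : ℕ → List Term → Term

infixr 6 _∧ᶠ_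
infixr 5 _∨ᶠ_
infixr 4 _⊃ᶠ_

data Formula : Set where
  ⊤ᶠ ⊥ᶠ : Formula
  atom  : ℕ → List Term → Formula
  _∧ᶠ_ _∨ᶠ_ _⊃ᶠ_ : Formula → Formula → Formula
  ∃ᶠ ∀ᶠ : Formula → Formula      -- binds de Bruijn index 0 in the body

mutual
  shiftT : ℕ → Term → Term
  shiftT c (var n) = if n <ᵇ c then var n else var (suc n)
  shiftT c (con k) = con k
  shiftT c (fun f ts) = fun f (shiftTs c ts)

  shiftTs : ℕ → List Term → List Term
  shiftTs c [] = []
  shiftTs c (t ∷ ts) = shiftT c t ∷ shiftTs c ts

shiftN : ℕ → Term → Term
shiftN zero u = u
shiftN (suc k) u = shiftT 0 (shiftN k u)

mutual
  substT : ℕ → Term → Term → Term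
  substT k u (var n) =
    if n ≡ᵇ k then shiftN k u else (if k <ᵇ n then var (pred' n) else var n)
    where
      pred' : ℕ → ℕ
      pred' zero = zero
      pred' (suc m) = m
  substT k u (con c) = con c
  substT k u (fun f ts) = fun f (substTs k u ts)

  substTs : ℕ → Term → List Term → List Term
  substTs k u [] = []
  substTs k u (t ∷ ts) = substT k u t ∷ substTs k u ts

substF : ℕ → Term → Formula → Formula
substF k u ⊤ᶠ = ⊤ᶠ
substF k u ⊥ᶠ = ⊥ᶠ
substF k u (atom p ts) = atom p (substTs k u ts)
substF k u (A ∧ᶠ B) = substF k u A ∧ᶠ substF k u B
substF k u (A ∨ᶠ B) = substF k u A ∨ᶠ substF k u B
substF k u (A ⊃ᶠ B) = substF k u A ⊃ᶠ substF k u B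
substF k u (∃ᶠ A) = ∃ᶠ (substF (suc k) u A)
substF k u (∀ᶠ A) = ∀ᶠ (substF (suc k) u A)

[_/x]_ : Term → Formula → Formula
[ t /x] B = substF 0 t B

mutual
  occT : ℕ → Term → Bool
  occT c (var n) = false
  occT c (con k) = c ≡ᵇ k
  occT c (fun f ts) = occTs c ts

  occTs : ℕ → List Term → Bool
  occTs c [] = false
  occTs c (t ∷ ts) = occT c t ∨ occTs c ts

occF : ℕ → Formula → Bool
occF c ⊤ᶠ = false
occF c ⊥ᶠ = false
occF c (atom p ts) = occTs c ts
occF c (A ∧ᶠ B) = occF c A ∨ occF c B
occF c (A ∨ᶠ B) = occF c A ∨ occF c B
occF c (A ⊃ᶠ B) = occF c A ∨ occF c B
occF c (∃ᶠ A) = occF c A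
occF c (∀ᶠ A) = occF c A

occL : ℕ → List Formula → Bool
occL c [] = false
occL c (A ∷ As) = occF c A ∨ occL c As

-- Sequents: pairs of finite multisets, represented as lists; the rules
-- below match the lower sequent only up to permutation (_↭_).

Sequent : Set
Sequent = List Formula × List Formula

AtomOrBot : Formula → Set
AtomOrBot ⊥ᶠ = ⊤
AtomOrBot (atom _ _) = ⊤
AtomOrBot _ = ⊥

Fresh : ℕ → List Formula → List Formula → Set
Fresh c Γ Δ = (occL c Γ ∨ occL c Δ) ≡ false

-- C-proofs of a sequent Γ ⟶ Δ.  Succedent "Δ, B" is written B ∷ Δ.
data Proof : List Formula → List Formula → Set where
  ax⊤ : ∀ {Γ Δ} → ⊤ᶠ ∈ Δ → Proof Γ Δ
  ax  : ∀ {Γ Δ} A → AtomOrBot A → A ∈ Γ → A ∈ Δ → Proof Γ Δ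
  contrL : ∀ {Γ Δ} Γ₀ B → Γ ↭ B ∷ Γ₀ →
           Proof (B ∷ B ∷ Γ₀) Δ → Proof Γ Δ
  contrR : ∀ {Γ Δ} Δ₀ B → Δ ↭ B ∷ Δ₀ →
           Proof Γ (B ∷ B ∷ Δ₀) → Proof Γ Δ
  ⊥R : ∀ {Γ Δ} Δ₀ D → Δ ↭ D ∷ Δ₀ →
       Proof Γ (⊥ᶠ ∷ Δ₀) → Proof Γ Δ
  ∧L : ∀ {Γ Δ} Γ₀ B D → Γ ↭ (B ∧ᶠ D) ∷ Γ₀ →
       Proof (B ∷ D ∷ (B ∧ᶠ D) ∷ Γ₀) Δ → Proof Γ Δ
  ∧R : ∀ {Γ Δ} Δ₀ B D → Δ ↭ (B ∧ᶠ D) ∷ Δ₀ →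
       Proof Γ (B ∷ Δ₀) → Proof Γ (D ∷ Δ₀) → Proof Γ Δ
  ∨L : ∀ {Γ Δ} Γ₀ B D → Γ ↭ (B ∨ᶠ D) ∷ Γ₀ →
       Proof (B ∷ Γ₀) Δ → Proof (D ∷ Γ₀) Δ → Proof Γ Δ
  ∨R₁ : ∀ {Γ Δ} Δ₀ B D → Δ ↭ (B ∨ᶠ D) ∷ Δ₀ →
        Proof Γ (B ∷ Δ₀) → Proof Γ Δ
  ∨R₂ : ∀ {Γ Δ} Δ₀ B D → Δ ↭ (B ∨ᶠ D) ∷ Δ₀ →
        Proof Γ (D ∷ Δ₀) → Proof Γ Δ
  ⊃L : ∀ {Γ Δ} Γ₀ Δ₀ Θ B D → Γ ↭ (B ⊃ᶠ D) ∷ Γ₀ → Δ ↭ Δ₀ ++ Θ →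
       Proof ((B ⊃ᶠ D) ∷ Γ₀) (B ∷ Δ₀) → Proof (D ∷ Γ₀) Θ → Proof Γ Δ
  ⊃R : ∀ {Γ Δ} Δ₀ B D → Δ ↭ (B ⊃ᶠ D) ∷ Δ₀ →
       Proof (B ∷ Γ) (D ∷ Δ₀) → Proof Γ Δ
  ∀L : ∀ {Γ Δ} Γ₀ B (t : Term) → Γ ↭ ∀ᶠ B ∷ Γ₀ →
       Proof ([ t /x] B ∷ ∀ᶠ B ∷ Γ₀) Δ → Proof Γ Δ
  ∃R : ∀ {Γ Δ} Δ₀ B (t : Term) → Δ ↭ ∃ᶠ B ∷ Δ₀ →
       Proof Γ ([ t /x] B ∷ Δ₀) → Proof Γ Δ
  ∃L : ∀ {Γ Δ} Γ₀ B (c : ℕ) → Γ ↭ ∃ᶠ B ∷ Γ₀ → Fresh c Γ Δ →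
       Proof ([ con c /x] B ∷ Γ₀) Δ → Proof Γ Δ
  ∀R : ∀ {Γ Δ} Δ₀ B (c : ℕ) → Δ ↭ ∀ᶠ B ∷ Δ₀ → Fresh c Γ Δ →
       Proof Γ ([ con c /x] B ∷ Δ₀) → Proof Γ Δ

Deriv : Set
Deriv = Σ Sequent λ s → Proof (proj₁ s) (proj₂ s)

premises : ∀ {Γ Δ} → Proof Γ Δ → List Deriv
premises (ax⊤ _) = []
premises (ax _ _ _ _) = []
premises (contrL _ _ _ p) = (_ , p) ∷ []
premises (contrR _ _ _ p) = (_ , p) ∷ []
premises (⊥R _ _ _ p) = (_ , p) ∷ []
premises (∧L _ _ _ _ p) = (_ , p) ∷ []
premises (∧R _ _ _ _ p q) = (_ , p) ∷ (_ , q) ∷ []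
premises (∨L _ _ _ _ p q) = (_ , p) ∷ (_ , q) ∷ []
premises (∨R₁ _ _ _ _ p) = (_ , p) ∷ []
premises (∨R₂ _ _ _ _ p) = (_ , p) ∷ []
premises (⊃L _ _ _ _ _ _ _ p q) = (_ , p) ∷ (_ , q) ∷ []
premises (⊃R _ _ _ _ p) = (_ , p) ∷ []
premises (∀L _ _ _ _ p) = (_ , p) ∷ []
premises (∃R _ _ _ _ p) = (_ , p) ∷ []
premises (∃L _ _ _ _ _ p) = (_ , p) ∷ []
premises (∀R _ _ _ _ _ p) = (_ , p) ∷ []

-- d ⊑ e : d is a (reflexively) subderivation of e, i.e. the end-sequent
-- of d lies on a path from a leaf of e down to the end-sequent of e,
-- at or above the end-sequent of e.
data _⊑_ : Deriv → Deriv → Set where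
  here  : ∀ {d} → d ⊑ d
  there : ∀ {d e s} {p : Proof (proj₁ s) (proj₂ s)} →
          e ∈ premises p → d ⊑ e → d ⊑ (s , p)

IProof : Deriv → Set
IProof π = ∀ d → d ⊑ π → length (proj₂ (proj₁ d)) ≡ 1

infix 4 _⪰_ _⪰ₘ_

data _⪰_ : Formula → Formula → Set where
  ⪰-refl : ∀ {F} → F ⪰ F
  ⪰-⊃ : ∀ {F A B} → F ⪰ B → F ⪰ (A ⊃ᶠ B)
  ⪰-∨₁ : ∀ {F A B} → F ⪰ A → F ⪰ (A ∨ᶠ B)
  ⪰-∨₂ : ∀ {F A B} → F ⪰ B → F ⪰ (A ∨ᶠ B)
  ⪰-∃ : ∀ {F P} (c : ℕ) → F ⪰ [ con c /x] P → F ⪰ ∃ᶠ P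

_⪰ₘ_ : List Formula → List Formula → Set
Γ₁ ⪰ₘ Γ₂ = Σ (Fin (length Γ₂) → Fin (length Γ₁)) λ κ →
  Injective _≡_ _≡_ κ × (∀ i → lookup Γ₁ (κ i) ⪰ lookup Γ₂ i)

{-# OPTIONS --safe #-}
-- Every rule either leaves the antecedent alone, adds side formulas to it, or
-- replaces its principal formula by one dominating it (a disjunct, the
-- consequent of an implication, an instance of an existential).  So the
-- antecedent of each premise dominates that of the conclusion, and ⪰ₘ is
-- transitive along the path.
module Submission where

open import Defs
open import Data.Fin using (zero; suc)
open import Data.Fin.Permutation using (_⟨$⟩ʳ_)
open import Data.Fin.Properties using (suc-injective)
open import Data.List using (List; []; _∷_; _++_)
open import Data.List.Membership.Propositional using (_∈_)
open import Data.List.Relation.Binary.Permutation.Propositional using (_↭_; ↭⇒↭ₛ)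
open import Data.List.Relation.Binary.Permutation.Setoid using (onIndices)
open import Data.List.Relation.Binary.Permutation.Setoid.Properties using (onIndices-lookup)
open import Data.List.Relation.Unary.Any using (here; there)
open import Data.Product using (_×_; _,_; proj₁)
open import Function using (flip)
open import Function.Bundles using (Injection)
open import Function.Properties.Inverse using (↔⇒↣)
open import Relation.Binary.Bundles using (Preorder)
open import Relation.Binary.PropositionalEquality using (_≡_; refl; subst; setoid; isEquivalence)
import Relation.Binary.Reasoning.Preorder as PreorderReasoning

private
  variable
    F G H X Y : Formula
    Γ Γ₀ Δ Θ : List Formula
    d₁ d₂ e : Deriv

⪰-trans : F ⪰ G → G ⪰ H → F ⪰ H
⪰-trans F⪰G ⪰-refl      = F⪰G
⪰-trans F⪰G (⪰-⊃ G⪰)    = ⪰-⊃ (⪰-trans F⪰G G⪰)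
⪰-trans F⪰G (⪰-∨₁ G⪰)   = ⪰-∨₁ (⪰-trans F⪰G G⪰)
⪰-trans F⪰G (⪰-∨₂ G⪰)   = ⪰-∨₂ (⪰-trans F⪰G G⪰)
⪰-trans F⪰G (⪰-∃ c G⪰)  = ⪰-∃ c (⪰-trans F⪰G G⪰)

-- _⪰ₘ_ unfolds to a Σ-type, so Agda cannot infer its list arguments: they are
-- passed explicitly, and chains of ⪰ₘ go through preorder reasoning.
⪰ₘ-refl : ∀ Γ → Γ ⪰ₘ Γ
⪰ₘ-refl Γ = (λ i → i) , (λ eq → eq) , (λ _ → ⪰-refl)

⪰ₘ-trans : Γ ⪰ₘ Δ → Δ ⪰ₘ Θ → Γ ⪰ₘ Θ
⪰ₘ-trans (κ , κ-injective , κ-⪰) (ι , ι-injective , ι-⪰) =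
  (λ i → κ (ι i)) , (λ eq → ι-injective (κ-injective eq)) , (λ i → ⪰-trans (κ-⪰ (ι i)) (ι-⪰ i))

⪯ₘ-preorder : Preorder _ _ _
⪯ₘ-preorder = record
  { Carrier    = List Formula
  ; _≈_        = _≡_
  ; _≲_        = flip _⪰ₘ_
  ; isPreorder = record
    { isEquivalence = isEquivalence
    ; reflexive     = λ { {Γ} refl → ⪰ₘ-refl Γ }
    ; trans         = λ {Γ} {Δ} {Θ} Δ⪰Γ Θ⪰Δ → ⪰ₘ-trans {Θ} {Δ} {Γ} Θ⪰Δ Δ⪰Γ
    }
  }

open PreorderReasoning ⪯ₘ-preorder

⪰ₘ-++ : ∀ Θ Γ → Θ ++ Γ ⪰ₘ Γ
⪰ₘ-++ []      Γ = ⪰ₘ-refl Γ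
⪰ₘ-++ (F ∷ Θ) Γ with ⪰ₘ-++ Θ Γ
... | κ , κ-injective , κ-⪰ = (λ i → suc (κ i)) , (λ eq → κ-injective (suc-injective eq)) , κ-⪰

⪰ₘ-head : F ⪰ G → ∀ Γ → F ∷ Γ ⪰ₘ G ∷ Γ
⪰ₘ-head F⪰G Γ = (λ i → i) , (λ eq → eq) , λ { zero → F⪰G ; (suc _) → ⪰-refl }

↭⇒⪰ₘ : Γ ↭ Δ → Δ ⪰ₘ Γ
↭⇒⪰ₘ Γ↭Δ = (π ⟨$⟩ʳ_) , Injection.injective (↔⇒↣ π) , λ i →
  subst (_⪰ _) (onIndices-lookup (setoid Formula) Γ↭ₛΔ i) ⪰-refl
  where
  Γ↭ₛΔ = ↭⇒↭ₛ Γ↭Δ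
  π = onIndices Γ↭ₛΔ

⪰ₘ-principal : Γ ↭ X ∷ Γ₀ → Y ⪰ X → ∀ Θ → Θ ++ Y ∷ Γ₀ ⪰ₘ Γ
⪰ₘ-principal {Γ} {X} {Γ₀} {Y} Γ↭XΓ₀ Y⪰X Θ = begin
  Γ            ≲⟨ ↭⇒⪰ₘ Γ↭XΓ₀ ⟩
  X ∷ Γ₀       ≲⟨ ⪰ₘ-head Y⪰X Γ₀ ⟩
  Y ∷ Γ₀       ≲⟨ ⪰ₘ-++ Θ (Y ∷ Γ₀) ⟩
  Θ ++ Y ∷ Γ₀  ∎

antecedent : Deriv → List Formula
antecedent d = proj₁ (proj₁ d)

premise-⪰ₘ : (p : Proof Γ Δ) → e ∈ premises p → antecedent e ⪰ₘ Γ
premise-⪰ₘ     (contrL _ B Γ↭ _)          (here refl)         = ⪰ₘ-principal Γ↭ ⪰-refl (B ∷ [])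
premise-⪰ₘ {Γ} (contrR _ _ _ _)           (here refl)         = ⪰ₘ-refl Γ
premise-⪰ₘ {Γ} (⊥R _ _ _ _)               (here refl)         = ⪰ₘ-refl Γ
premise-⪰ₘ     (∧L _ B D Γ↭ _)            (here refl)         = ⪰ₘ-principal Γ↭ ⪰-refl (B ∷ D ∷ [])
premise-⪰ₘ {Γ} (∧R _ _ _ _ _ _)           (here refl)         = ⪰ₘ-refl Γ
premise-⪰ₘ {Γ} (∧R _ _ _ _ _ _)           (there (here refl)) = ⪰ₘ-refl Γ
premise-⪰ₘ     (∨L _ _ _ Γ↭ _ _)          (here refl)         = ⪰ₘ-principal Γ↭ (⪰-∨₁ ⪰-refl) []
premise-⪰ₘ     (∨L _ _ _ Γ↭ _ _)          (there (here refl)) = ⪰ₘ-principal Γ↭ (⪰-∨₂ ⪰-refl) []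
premise-⪰ₘ {Γ} (∨R₁ _ _ _ _ _)            (here refl)         = ⪰ₘ-refl Γ
premise-⪰ₘ {Γ} (∨R₂ _ _ _ _ _)            (here refl)         = ⪰ₘ-refl Γ
premise-⪰ₘ     (⊃L _ _ _ _ _ Γ↭ _ _ _)    (here refl)         = ⪰ₘ-principal Γ↭ ⪰-refl []
premise-⪰ₘ     (⊃L _ _ _ _ _ Γ↭ _ _ _)    (there (here refl)) = ⪰ₘ-principal Γ↭ (⪰-⊃ ⪰-refl) []
premise-⪰ₘ {Γ} (⊃R _ B _ _ _)             (here refl)         = ⪰ₘ-++ (B ∷ []) Γ
premise-⪰ₘ     (∀L _ B t Γ↭ _)            (here refl)         = ⪰ₘ-principal Γ↭ ⪰-refl ([ t /x] B ∷ [])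
premise-⪰ₘ {Γ} (∃R _ _ _ _ _)             (here refl)         = ⪰ₘ-refl Γ
premise-⪰ₘ     (∃L _ _ c Γ↭ _ _)          (here refl)         = ⪰ₘ-principal Γ↭ (⪰-∃ c ⪰-refl) []
premise-⪰ₘ {Γ} (∀R _ _ _ _ _ _)           (here refl)         = ⪰ₘ-refl Γ

⊑⇒⪰ₘ : d₁ ⊑ d₂ → antecedent d₁ ⪰ₘ antecedent d₂
⊑⇒⪰ₘ {d₁} here = ⪰ₘ-refl (antecedent d₁)
⊑⇒⪰ₘ {d₁} (there {e = e} {s = s} {p = p} e∈premises d₁⊑e) = begin
  proj₁ s          ≲⟨ premise-⪰ₘ p e∈premises ⟩
  antecedent e     ≲⟨ ⊑⇒⪰ₘ d₁⊑e ⟩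
  antecedent d₁    ∎

lemma4 : (∀ (π d₁ d₂ : Deriv) → d₁ ⊑ d₂ → d₂ ⊑ π →
            proj₁ (proj₁ d₁) ⪰ₘ proj₁ (proj₁ d₂))
       × (∀ (π d₁ d₂ : Deriv) → IProof π → d₁ ⊑ d₂ → d₂ ⊑ π →
            proj₁ (proj₁ d₁) ⪰ₘ proj₁ (proj₁ d₂))
lemma4 = (λ _ _ _ d₁⊑d₂ _ → ⊑⇒⪰ₘ d₁⊑d₂) , (λ _ _ _ _ d₁⊑d₂ _ → ⊑⇒⪰ₘ d₁⊑d₂)
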